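{- Let $k,r,p>0$ and let $F:N^k\to N^r$ satisfy $|F(x)|\le\min(x)$ for all $x\in N^k$. Then there exists a $p$-element set $E\subseteq N$ such that the image $F[E^k]$ has cardinality at most $k^k\cdot p$.
   Context: $N=\{0,1,2,\dots\}$. For $x\in N^k$, $\min(x)$ is the least coordinate of $x$ and $|x|$ is the largest coordinate of $x$. -}

module Defs where

open import Data.Nat using (ℕ; _⊔_; _⊓_)
open import Data.Vec using (Vec; []; _∷_)

-- |x| : the largest coordinate of x ∈ ℕ^n (0 for n = 0)
maxV : ∀ {n} → Vec ℕ n → ℕ
maxV [] = 0
maxV (a ∷ v) = a ⊔ maxV v

minV : ∀ {n} → Vec ℕ n → ℕ
minV [] = 0
minV (a ∷ []) = a
minV (a ∷ b ∷ v) = a ⊓ minV (b ∷ v)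

-- Write Bar Q xs for the inductive statement that every way of extending xs one element
-- at a time eventually reaches a list satisfying Q; this replaces "sufficiently long"
-- constructively. A property P of lists is Ramsey if, whenever Q is such a bar, so is
-- "some sublist satisfies P and Q". By the Erdős–Rado argument (a pre-homogeneous tree
-- followed by the pigeonhole principle), homogeneity for a bounded colouring of k-sublists
-- is Ramsey, and so is min-homogeneity for a regressive colouring, c (t ∷ v) ≤ t.
--
-- For the theorem, colour t ∷ v, for each pattern σ ∈ kᵏ and coordinate j < r, by
-- F (σ realised on t ∷ v)ⱼ ⊓ t, and follow the bar along 0, 1, 2, … to obtain a sorted H
-- with at least p + k − 1 elements that is min-homogeneous for all these colourings; E is the
-- first p elements of H. A point x ∈ Eᵏ with least coordinate m is the realisation of some
-- σ on m followed by k − 1 later elements of H, and F x ≤ m coordinatewise, so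
-- min-homogeneity lets these be replaced by the k − 1 elements of H right after m. Hence
-- F x is one of the kᵏ values attached to each of the p possible m.
module Submission where

open import Defs
open import Data.Nat using (ℕ; _≤_; _<_; _*_; _^_)
open import Data.Vec using (Vec)
open import Data.Vec.Relation.Unary.All using (All)
open import Data.List using (List; length)
open import Data.List.Relation.Unary.Unique.Propositional using (Unique)
open import Data.List.Membership.Propositional using (_∈_)
open import Data.Product using (Σ; _×_)
open import Relation.Binary.PropositionalEquality using (_≡_)

open import Data.Empty using (⊥-elim)
open import Data.Fin as Fin using (Fin; zero; suc; toℕ; fromℕ<)
open import Data.Fin.Properties using (toℕ-fromℕ<)
open import Data.List
  using ( []; _∷_; [_]; _++_; _∷ʳ_; map; take; drop; filter; upTo; applyUpTo; allFin
        ; cartesianProduct; cartesianProductWith)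
open import Data.List.Membership.DecPropositional Data.Nat._≟_ using (_∈?_)
open import Data.List.Membership.Propositional.Properties
  using ( ∈-++⁺ˡ; ∈-++⁺ʳ; ∈-++⁻; ∈-map⁺; ∈-∃++; ∈-allFin; ∈-upTo⁺; ∈-cartesianProduct⁺
        ; ∈-cartesianProductWith⁺; ∈-filter⁺; ∈-filter⁻)
open import Data.List.Properties
  using ( ++-assoc; ++-identityʳ; length-++; length-map; length-take; length-drop; length-upTo
        ; take++drop≡id; map-++; filter-++; filter-accept; filter-reject; applyUpTo-∷ʳ)
open import Data.List.Relation.Binary.Sublist.Propositional
  using (_⊆_; []; _∷_; ⊆-refl; ⊆-trans) renaming (_∷ʳ_ to _∷ˢ_)
open import Data.List.Relation.Binary.Sublist.Propositional.Properties
  using (All-resp-⊆; map⁺; take-⊆; filter-⊆; ++⁺; ++⁺ˡ; ++⁺ʳ; length-mono-≤)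
import Data.List.Relation.Unary.All as LAll
open LAll using ([]; _∷_)
open import Data.List.Relation.Unary.All.Properties using (all-filter)
open import Data.List.Relation.Unary.AllPairs as AllPairs using (AllPairs; []; _∷_)
open import Data.List.Relation.Unary.AllPairs.Properties using (applyUpTo⁺₁)
open import Data.List.Relation.Unary.Any using (here; there)
open import Data.Vec.Relation.Unary.Any using (here; there)
open import Data.Nat using (zero; suc; _+_; _∸_; _⊓_; z≤n; s≤s; s≤s⁻¹; z<s; _≟_; _≤?_)
open import Data.Nat.Properties
open import Data.Product using (_,_; proj₁; proj₂; swap; uncurry)
open import Data.Sum using (_⊎_; inj₁; inj₂; [_,_]′)
open import Data.Unit using (⊤; tt)
import Data.Vec as V
open V using ([]; _∷_; lookup; tabulate)
open import Data.Vec.Properties using (tabulate∘lookup; tabulate-cong; length-toList)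
import Data.Vec.Relation.Unary.All as VAll
open VAll using ([]; _∷_)
open import Data.Vec.Membership.Propositional using () renaming (_∈_ to _∈ᵥ_)
open import Data.Vec.Membership.Propositional.Properties
  using () renaming (∈-map⁺ to ∈ᵥ-map⁺; ∈-toList⁺ to ∈ᵥ-toList⁺)
open import Function using (id; _∘_)
open import Relation.Binary.PropositionalEquality
  using (_≢_; refl; sym; trans; cong; cong₂; subst; module ≡-Reasoning)
open import Relation.Nullary using (¬_; yes; no)
open import Relation.Nullary.Decidable using (toSum)
open import Relation.Unary using (Decidable; _∩_)
open import Relation.Unary.Properties using (∁?)

private
  variable
    A B C : Set
    t a : A
    xs ys zs : List A
    P Q : List A → Set
    k γ : ℕ
    c : List A → ℕ

data Bar {A : Set} (Q : List A → Set) : List A → Set where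
  now   : ∀ {xs} → Q xs → Bar Q xs
  later : ∀ {xs} → (∀ a → Bar Q (xs ∷ʳ a)) → Bar Q xs

Extensible : (List A → Set) → Set
Extensible P = ∀ {xs} a → P xs → P (xs ∷ʳ a)

Bar-map : (∀ {xs} → P xs → Q xs) → Bar P xs → Bar Q xs
Bar-map f (now p)   = now (f p)
Bar-map f (later h) = later λ a → Bar-map f (h a)

Bar-with : Extensible P → P xs → Bar Q xs → Bar (P ∩ Q) xs
Bar-with extP p (now q)   = now (p , q)
Bar-with extP p (later h) = later λ a → Bar-with extP (extP a p) (h a)

Bar-∩ : Extensible P → Extensible Q → Bar P xs → Bar Q xs → Bar (P ∩ Q) xs
Bar-∩ extP extQ (now p)   bQ        = Bar-with extP p bQ
Bar-∩ extP extQ (later h) (now q)   = Bar-map swap (Bar-with extQ q (later h))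
Bar-∩ extP extQ (later h) (later g) = later λ a → Bar-∩ extP extQ (h a) (g a)

Bar-∀≤ : {R : ℕ → List A → Set} → (∀ γ → Extensible (R γ)) → (∀ γ → Bar (R γ) xs) →
         ∀ N → Bar (λ ys → ∀ γ → γ ≤ N → R γ ys) xs
Bar-∀≤ ext bars zero    = Bar-map (λ { r zero z≤n → r }) (bars zero)
Bar-∀≤ {R = R} ext bars (suc N) =
  Bar-map join (Bar-∩ ext-below (ext (suc N)) (Bar-∀≤ ext bars N) (bars (suc N)))
  where
  ext-below : Extensible (λ ys → ∀ γ → γ ≤ N → R γ ys)
  ext-below a below γ γ≤N = ext γ a (below γ γ≤N)
  join : ∀ {ys} → (∀ γ → γ ≤ N → R γ ys) × R (suc N) ys → ∀ γ → γ ≤ suc N → R γ ys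
  join (below , top) γ γ≤ with m≤n⇒m<n∨m≡n γ≤
  ... | inj₁ γ<    = below γ (s≤s⁻¹ γ<)
  ... | inj₂ refl = top

Bar-++ˡ : (zs : List A) → (∀ {ys} → P ys → Q (zs ++ ys)) → Bar P ys → Bar Q (zs ++ ys)
Bar-++ˡ zs f (now p) = now (f p)
Bar-++ˡ {Q = Q} {ys = ys} zs f (later h) =
  later λ a → subst (Bar Q) (sym (++-assoc zs ys [ a ])) (Bar-++ˡ zs f (h a))

Bar-comap : (f : A → B) {Q : List B → Set} {ys : List B} →
            Bar Q ys → map f xs ≡ ys → Bar (Q ∘ map f) xs
Bar-comap f (now q) refl = now q
Bar-comap {xs = xs} f (later h) refl = later λ a → Bar-comap f (h (f a)) (map-++ f xs [ a ])

filter-∷ʳ-accept : ∀ {D : A → Set} (D? : Decidable D) → D a →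
                   filter D? (xs ∷ʳ a) ≡ filter D? xs ∷ʳ a
filter-∷ʳ-accept {xs = xs} D? d =
  trans (filter-++ D? xs [ _ ]) (cong (filter D? xs ++_) (filter-accept D? d))

filter-∷ʳ-reject : ∀ {D : A → Set} (D? : Decidable D) → ¬ D a → filter D? (xs ∷ʳ a) ≡ filter D? xs
filter-∷ʳ-reject {xs = xs} D? ¬d =
  trans (filter-++ D? xs [ _ ]) (trans (cong (filter D? xs ++_) (filter-reject D? ¬d)) (++-identityʳ _))

module _ {D : A → Set} (D? : Decidable D) where

  -- The indices are tied to the filtered lists by equations rather than by subst, which
  -- keeps the recursion structural in the two bars.
  Bar-partition : Bar P ys → Bar Q zs → filter D? xs ≡ ys → filter (∁? D?) xs ≡ zs →
                  Bar (λ xs → P (filter D? xs) ⊎ Q (filter (∁? D?) xs)) xs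
  Bar-partition (now p)   _         refl _    = now (inj₁ p)
  Bar-partition (later _) (now q)   _    refl = now (inj₂ q)
  Bar-partition {xs = xs} (later h) (later g) refl refl = later λ a → [
      (λ d → Bar-partition (h a) (later g) (filter-∷ʳ-accept {xs = xs} D? d)
                           (filter-∷ʳ-reject {xs = xs} (∁? D?) (λ ¬d → ¬d d))) ,
      (λ ¬d → Bar-partition (later h) (g a) (filter-∷ʳ-reject {xs = xs} D? ¬d)
                            (filter-∷ʳ-accept {xs = xs} (∁? D?) ¬d)) ]′ (toSum (D? a))

SomeSublist : (List A → Set) → List A → Set
SomeSublist {A} P xs = Σ (List A) λ S → S ⊆ xs × P S

Monochromatic : (A → B) → List A → Set
Monochromatic {B = B} κ S = Σ B λ g → LAll.All (λ a → κ a ≡ g) S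

pigeonhole : ∀ n (κ : A → Fin (suc n)) → Bar Q [] → Bar (SomeSublist (Monochromatic κ ∩ Q)) []
pigeonhole zero κ = Bar-map λ {xs} q → xs , ⊆-refl , (zero , LAll.tabulate λ {a} _ → Fin1-zero (κ a)) , q
  where
  Fin1-zero : (i : Fin 1) → i ≡ zero
  Fin1-zero zero = refl
pigeonhole {A = A} {Q = Q} (suc n) κ bQ =
  Bar-map merge (Bar-partition D? bQ (pigeonhole n (predFin ∘ κ) bQ) refl refl)
  where
  predFin : Fin (suc (suc n)) → Fin (suc n)
  predFin zero    = zero
  predFin (suc i) = i
  D : A → Set
  D a = κ a ≡ zero
  D? : Decidable D
  D? a = κ a Fin.≟ zero
  suc-predFin : ∀ {i g} → i ≢ zero → predFin i ≡ g → i ≡ suc g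
  suc-predFin {zero}  i≢0 _    = ⊥-elim (i≢0 refl)
  suc-predFin {suc i} _   refl = refl
  merge : ∀ {xs} →
          Q (filter D? xs) ⊎ SomeSublist (Monochromatic (predFin ∘ κ) ∩ Q) (filter (∁? D?) xs) →
          SomeSublist (Monochromatic κ ∩ Q) xs
  merge {xs} (inj₁ q) = filter D? xs , filter-⊆ D? xs , (zero , all-filter D? xs) , q
  merge {xs} (inj₂ (S , S⊆ , (g , κS≡g) , q)) =
    S , ⊆-trans S⊆ (filter-⊆ (∁? D?) xs) ,
    (suc g , LAll.zipWith (uncurry suc-predFin) (All-resp-⊆ S⊆ (all-filter (∁? D?) xs) , κS≡g)) , q

Ramsey : (List A → Set) → Set₁
Ramsey {A} P = ∀ (Q : List A → Set) → Bar Q [] → Bar (SomeSublist (P ∩ Q)) []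

DownClosed : (List A → Set) → Set
DownClosed {A} P = ∀ {S xs : List A} → S ⊆ xs → P xs → P S

Ramsey-universal : (∀ xs → P xs) → Ramsey P
Ramsey-universal p Q = Bar-map λ {xs} q → xs , ⊆-refl , p xs , q

Ramsey-∩ : DownClosed P → Ramsey P → Ramsey Q → Ramsey (P ∩ Q)
Ramsey-∩ ↓P ramseyP ramseyQ R bR = Bar-map nest (ramseyP _ (ramseyQ R bR))
  where
  nest : ∀ {xs} → SomeSublist (_ ∩ SomeSublist (_ ∩ R)) xs → SomeSublist (_ ∩ R) xs
  nest (T , T⊆ , p , (S , S⊆ , q , r)) = S , ⊆-trans S⊆ T⊆ , (↓P S⊆ p , q) , r

Ramsey-All : {I : Set} {R : I → List A → Set} → (∀ i → DownClosed (R i)) → (∀ i → Ramsey (R i)) →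
             ∀ is → Ramsey (λ xs → LAll.All (λ i → R i xs) is)
Ramsey-All ↓R ramseyR []       = Ramsey-universal (λ _ → [])
Ramsey-All ↓R ramseyR (i ∷ is) Q bQ =
  Bar-map (λ { (S , S⊆ , (r , rs) , q) → S , S⊆ , r ∷ rs , q })
          (Ramsey-∩ (↓R i) (ramseyR i) (Ramsey-All ↓R ramseyR is) Q bQ)

length-take-≤ : ∀ {n} → n ≤ length xs → length (take n xs) ≡ n
length-take-≤ {xs = xs} {n} n≤ = trans (length-take n xs) (m≤n⇒m⊓n≡m n≤)

Homogeneous : ℕ → (List A → ℕ) → List A → Set
Homogeneous k c R = ∀ {v w} → v ⊆ R → w ⊆ R → length v ≡ k → length w ≡ k → c v ≡ c w

HomogeneousOfColour : ℕ → (List A → ℕ) → ℕ → List A → Set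
HomogeneousOfColour k c γ R = ∀ {v} → v ⊆ R → length v ≡ k → c v ≡ γ

Homogeneous-⊆ : DownClosed (Homogeneous {A} k c)
Homogeneous-⊆ S⊆ hom v⊆ w⊆ = hom (⊆-trans v⊆ S⊆) (⊆-trans w⊆ S⊆)

HomogeneousOfColour-⊆ : DownClosed (HomogeneousOfColour {A} k c γ)
HomogeneousOfColour-⊆ S⊆ hom v⊆ = hom (⊆-trans v⊆ S⊆)

HomogeneousOfColour⇒Homogeneous : ∀ {R : List A} → HomogeneousOfColour k c γ R → Homogeneous k c R
HomogeneousOfColour⇒Homogeneous hom v⊆ w⊆ |v| |w| = trans (hom v⊆ |v|) (sym (hom w⊆ |w|))

Homogeneous⇒HomogeneousOfColour : ∀ {R : List A} → Homogeneous k c R →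
                                  HomogeneousOfColour k c (c (take k R)) R
Homogeneous⇒HomogeneousOfColour {k = k} {R = R} hom {v} v⊆ |v| with k ≤? length R
... | yes k≤ = hom v⊆ (take-⊆ k R) |v| (length-take-≤ k≤)
... | no k≰ = ⊥-elim (k≰ (subst (_≤ length R) |v| (length-mono-≤ v⊆)))

MinHomogeneous : ℕ → (List A → ℕ) → List A → Set
MinHomogeneous k c []      = ⊤
MinHomogeneous k c (t ∷ E) = Homogeneous k (c ∘ (t ∷_)) E × MinHomogeneous k c E

MinHomogeneous-⊆ : DownClosed (MinHomogeneous {A} k c)
MinHomogeneous-⊆ []         _           = tt
MinHomogeneous-⊆ (_ ∷ˢ S⊆)  (_ , minHom)   = MinHomogeneous-⊆ S⊆ minHom
MinHomogeneous-⊆ (refl ∷ S⊆) (hom , minHom) = Homogeneous-⊆ S⊆ hom , MinHomogeneous-⊆ S⊆ minHom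

MinHomogeneous-at : ∀ (as : List A) {rest} → MinHomogeneous k c (as ++ t ∷ rest) →
                    Homogeneous k (c ∘ (t ∷_)) rest
MinHomogeneous-at []       (hom , _) = hom
MinHomogeneous-at (_ ∷ as) (_ , minHom) = MinHomogeneous-at as minHom

-- The end-homogeneous sets of the Erdős–Rado argument, each element paired with its colour.
module PreHomogeneous {A : Set} (k : ℕ) (c : List A → ℕ) (B : A → ℕ)
                      (c≤B : ∀ t v → c (t ∷ v) ≤ B t)
                      (ramsey : ∀ t → Ramsey (Homogeneous k (c ∘ (t ∷_)))) where

  PreHomogeneous : List (A × ℕ) → Set
  PreHomogeneous []             = ⊤
  PreHomogeneous ((t , γ) ∷ ps) =
    γ ≤ B t × HomogeneousOfColour k (c ∘ (t ∷_)) γ (map proj₁ ps) × PreHomogeneous ps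

  PreHomogeneous-⊆ : DownClosed PreHomogeneous
  PreHomogeneous-⊆ []          _                   = tt
  PreHomogeneous-⊆ (_ ∷ˢ S⊆)   (_ , _ , pre)       = PreHomogeneous-⊆ S⊆ pre
  PreHomogeneous-⊆ (refl ∷ S⊆) (γ≤B , hom , pre) =
    γ≤B , HomogeneousOfColour-⊆ (map⁺ proj₁ S⊆) hom , PreHomogeneous-⊆ S⊆ pre

  PreHomogeneous⇒bounded : ∀ {H} → PreHomogeneous H → LAll.All (λ p → proj₂ p ≤ B (proj₁ p)) H
  PreHomogeneous⇒bounded {[]}    _               = []
  PreHomogeneous⇒bounded {_ ∷ _} (γ≤B , _ , pre) = γ≤B ∷ PreHomogeneous⇒bounded pre

  PreHomogeneous⇒MinHomogeneous : ∀ {H} → PreHomogeneous H → MinHomogeneous k c (map proj₁ H)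
  PreHomogeneous⇒MinHomogeneous {[]}    _             = tt
  PreHomogeneous⇒MinHomogeneous {_ ∷ _} (_ , hom , pre) =
    HomogeneousOfColour⇒Homogeneous hom , PreHomogeneous⇒MinHomogeneous pre

  PreHomogeneous-uniform⇒HomogeneousOfColour :
    ∀ {H γ} → PreHomogeneous H → LAll.All (λ p → proj₂ p ≡ γ) H →
    HomogeneousOfColour (suc k) c γ (map proj₁ H)
  PreHomogeneous-uniform⇒HomogeneousOfColour {[]} _ _ [] ()
  PreHomogeneous-uniform⇒HomogeneousOfColour {_ ∷ _} (_ , _ , pre) (_ ∷ uniform) (_ ∷ˢ v⊆) |v| =
    PreHomogeneous-uniform⇒HomogeneousOfColour pre uniform v⊆ |v|
  PreHomogeneous-uniform⇒HomogeneousOfColour {_ ∷ _} (_ , hom , _) (refl ∷ _) (refl ∷ v⊆) |v| =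
    hom v⊆ (suc-injective |v|)

  Completion : (List (A × ℕ) → Set) → List (A × ℕ) → List A → Set
  Completion W ps xs = Σ (List (A × ℕ)) λ H → map proj₁ H ⊆ xs × PreHomogeneous H × W (ps ++ H)

  Completion-extensible : ∀ W ps → Extensible (Completion W ps)
  Completion-extensible W ps {xs} a (H , H⊆ , pre , w) = H , ⊆-trans H⊆ (++⁺ʳ [ a ] ⊆-refl) , pre , w

  -- Having read t, the Ramsey property of c (t ∷ ·) finds a later homogeneous R; its colour
  -- c (t ∷ take k R) is one of the values γ ≤ B t, and the induction hypothesis for every
  -- such γ has been run inside R in advance.
  completion-bar : ∀ {W} ps → Bar W ps → Bar (Completion W ps) []
  completion-bar {W} ps (now w)   = now ([] , [] , tt , subst W (sym (++-identityʳ ps)) w)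
  completion-bar {W} ps (later h) =
    later λ t → Bar-++ˡ [ t ] (extend t) (ramsey t (AllColours t) (allColours-bar t))
    where
    AllColours : A → List A → Set
    AllColours t R = ∀ γ → γ ≤ B t → Completion W (ps ∷ʳ (t , γ)) R
    allColours-bar : ∀ t → Bar (AllColours t) []
    allColours-bar t =
      Bar-∀≤ (λ γ → Completion-extensible W _)
             (λ γ → completion-bar (ps ∷ʳ (t , γ)) (h (t , γ))) (B t)
    extend : ∀ t {ys} → SomeSublist (Homogeneous k (c ∘ (t ∷_)) ∩ AllColours t) ys → Completion W ps (t ∷ ys)
    extend t (R , R⊆ , homR , allR) with allR (c (t ∷ take k R)) (c≤B t _)
    ... | H , H⊆ , pre , w =
      (t , c (t ∷ take k R)) ∷ H , refl ∷ ⊆-trans H⊆ R⊆ ,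
      (c≤B t _ , HomogeneousOfColour-⊆ H⊆ (Homogeneous⇒HomogeneousOfColour homR) , pre) ,
      subst W (++-assoc ps [ _ ] H) w

ramsey-homogeneous : ∀ k C (c : List A → ℕ) → (∀ v → c v ≤ C) → Ramsey (Homogeneous k c)
ramsey-homogeneous zero C c c≤C = Ramsey-universal homogeneous₀
  where
  homogeneous₀ : ∀ R → Homogeneous 0 c R
  homogeneous₀ _ {[]}    {[]}    _ _ _  _  = refl
  homogeneous₀ _ {_ ∷ _} {_}     _ _ () _
  homogeneous₀ _ {[]}    {_ ∷ _} _ _ _  ()
ramsey-homogeneous {A} (suc k) C c c≤C Q bQ = Bar-map fromCompletion (completion-bar [] monochromatic-bar)
  where
  open PreHomogeneous k c (λ _ → C) (λ t v → c≤C (t ∷ v))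
                      (λ t → ramsey-homogeneous k C (c ∘ (t ∷_)) (c≤C ∘ (t ∷_)))
  -- Truncated so that κ is total; on pre-homogeneous pairs γ ≤ C, so nothing is lost.
  κ : A × ℕ → Fin (suc C)
  κ (_ , γ) = fromℕ< (s≤s (m⊓n≤n γ C))
  κ-toℕ : ∀ {p g} → proj₂ p ≤ C → κ p ≡ g → proj₂ p ≡ toℕ g
  κ-toℕ {p} γ≤C refl = sym (trans (toℕ-fromℕ< _) (m≤n⇒m⊓n≡m γ≤C))
  W : List (A × ℕ) → Set
  W = SomeSublist (Monochromatic κ ∩ (Q ∘ map proj₁))
  monochromatic-bar : Bar W []
  monochromatic-bar = pigeonhole C κ (Bar-comap proj₁ bQ refl)
  fromCompletion : ∀ {xs} → Completion W [] xs → SomeSublist (Homogeneous (suc k) c ∩ Q) xs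
  fromCompletion (H , H⊆ , pre , (S , S⊆ , (g , κS≡g) , q)) =
    map proj₁ S , ⊆-trans (map⁺ proj₁ S⊆) H⊆ ,
    HomogeneousOfColour⇒Homogeneous (PreHomogeneous-uniform⇒HomogeneousOfColour preS
      (LAll.zipWith (λ {p} → uncurry (κ-toℕ {p})) (PreHomogeneous⇒bounded preS , κS≡g))) , q
    where
    preS : PreHomogeneous S
    preS = PreHomogeneous-⊆ S⊆ pre

ramsey-minHomogeneous : ∀ k (c : List A → ℕ) (B : A → ℕ) → (∀ t v → c (t ∷ v) ≤ B t) →
                        Ramsey (MinHomogeneous k c)
ramsey-minHomogeneous k c B c≤B Q bQ = Bar-map fromCompletion (completion-bar [] (Bar-comap proj₁ bQ refl))
  where
  open PreHomogeneous k c B c≤B (λ t → ramsey-homogeneous k (B t) (c ∘ (t ∷_)) (c≤B t))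
  fromCompletion : ∀ {xs} → Completion (Q ∘ map proj₁) [] xs → SomeSublist (MinHomogeneous k c ∩ Q) xs
  fromCompletion (H , H⊆ , pre , q) = map proj₁ H , H⊆ , PreHomogeneous⇒MinHomogeneous pre , q

Bar-follow : (f : ℕ → A) → ∀ n → Bar Q ys → ys ≡ applyUpTo f n → Σ ℕ λ m → Q (applyUpTo f m)
Bar-follow f n (now q)   refl = n , q
Bar-follow f n (later h) refl = Bar-follow f (suc n) (h (f n)) (applyUpTo-∷ʳ f n)

Bar-length : ∀ d (xs : List A) → Bar (λ ys → length xs + d ≤ length ys) xs
Bar-length zero    xs = now (≤-reflexive (+-identityʳ _))
Bar-length (suc d) xs = later λ a → Bar-map (≤-trans (≤-reflexive (sym (|xs∷ʳa|+d a)))) (Bar-length d (xs ∷ʳ a))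
  where
  |xs∷ʳa|+d : ∀ a → length (xs ∷ʳ a) + d ≡ length xs + suc d
  |xs∷ʳa|+d a = trans (cong (_+ d) (length-++ xs)) (+-assoc (length xs) 1 d)

upTo-sorted : ∀ n → AllPairs _<_ (upTo n)
upTo-sorted n = applyUpTo⁺₁ id n (λ i<j _ → i<j)

AllPairs-resp-⊆ : ∀ {R : A → A → Set} {S xs} → S ⊆ xs → AllPairs R xs → AllPairs R S
AllPairs-resp-⊆ []          _           = []
AllPairs-resp-⊆ (_ ∷ˢ S⊆)   (_ ∷ rxs)   = AllPairs-resp-⊆ S⊆ rxs
AllPairs-resp-⊆ (refl ∷ S⊆) (rx ∷ rxs)  = All-resp-⊆ S⊆ rx ∷ AllPairs-resp-⊆ S⊆ rxs

AllPairs-∈-prefix : ∀ {R : A → A → Set} as {m rest} → AllPairs R (as ++ m ∷ rest) → a ∈ as → R a m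
AllPairs-∈-prefix (_ ∷ as) (ra ∷ _)  (here refl) = LAll.lookup ra (∈-++⁺ʳ as (here refl))
AllPairs-∈-prefix (_ ∷ as) (_ ∷ rxs) (there a∈)  = AllPairs-∈-prefix as rxs a∈

Unique-length-≤ : Unique xs → (∀ {y} → y ∈ xs → y ∈ ys) → length xs ≤ length ys
Unique-length-≤ []                   _   = z≤n
Unique-length-≤ {xs = x ∷ xs} (x∉xs ∷ unique) sub with ∈-∃++ (sub (here refl))
... | ys₁ , ys₂ , refl = ≤-trans (s≤s (Unique-length-≤ unique sub′)) (≤-reflexive |ys₁++x∷ys₂|)
  where
  |ys₁++x∷ys₂| : suc (length (ys₁ ++ ys₂)) ≡ length (ys₁ ++ x ∷ ys₂)
  |ys₁++x∷ys₂| = sym (trans (length-++ ys₁) (trans (+-suc _ _) (cong suc (sym (length-++ ys₁)))))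
  sub′ : ∀ {y} → y ∈ xs → y ∈ ys₁ ++ ys₂
  sub′ y∈xs with ∈-++⁻ ys₁ (sub (there y∈xs))
  ... | inj₁ y∈ys₁         = ∈-++⁺ˡ y∈ys₁
  ... | inj₂ (here refl)   = ⊥-elim (LAll.lookup x∉xs y∈xs refl)
  ... | inj₂ (there y∈ys₂) = ∈-++⁺ʳ ys₁ y∈ys₂

All-∈-toList : ∀ {n} (x : Vec A n) → VAll.All (_∈ V.toList x) x
All-∈-toList []      = []
All-∈-toList (a ∷ x) = here refl ∷ VAll.map there (All-∈-toList x)

covering-sublist : ∀ {n} (x : Vec ℕ (suc n)) {m bs pad} → Unique (m ∷ bs) → m ∈ᵥ x →
                   VAll.All (_∈ m ∷ bs) x → n ≤ length pad →
                   Σ (List ℕ) λ vx → vx ⊆ bs ++ pad × length vx ≡ n × VAll.All (_∈ m ∷ vx) x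
covering-sublist {n = n} x {m} {bs} {pad} (m∉bs ∷ unique) m∈x x⊆ n≤pad =
  vx , ++⁺ (filter-⊆ in-x? bs) (take-⊆ (n ∸ length D) pad) , |vx| ,
  VAll.map cover (VAll.zip (x⊆ , All-∈-toList x))
  where
  in-x? = _∈? V.toList x
  D = filter in-x? bs
  vx = D ++ take (n ∸ length D) pad
  m∷D-unique : Unique (m ∷ D)
  m∷D-unique = All-resp-⊆ (filter-⊆ in-x? bs) m∉bs ∷ AllPairs-resp-⊆ (filter-⊆ in-x? bs) unique
  m∷D⊆x : ∀ {y} → y ∈ m ∷ D → y ∈ V.toList x
  m∷D⊆x (here refl) = ∈ᵥ-toList⁺ m∈x
  m∷D⊆x (there y∈D) = proj₂ (∈-filter⁻ in-x? {xs = bs} y∈D)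
  |D|≤n : length D ≤ n
  |D|≤n = s≤s⁻¹ (subst (suc (length D) ≤_) (length-toList x) (Unique-length-≤ m∷D-unique m∷D⊆x))
  |vx| : length vx ≡ n
  |vx| = trans (length-++ D)
           (trans (cong (length D +_) (length-take-≤ (≤-trans (m∸n≤m n (length D)) n≤pad))) (m+[n∸m]≡n |D|≤n))
  cover : ∀ {y} → y ∈ m ∷ bs × y ∈ V.toList x → y ∈ m ∷ vx
  cover (here refl  , _)   = here refl
  cover (there y∈bs , y∈x) = there (∈-++⁺ˡ (∈-filter⁺ in-x? y∈bs y∈x))

minV-∈ : ∀ {n} (x : Vec ℕ (suc n)) → minV x ∈ᵥ x
minV-∈ (a ∷ [])    = here refl
minV-∈ (a ∷ b ∷ x) with ⊓-sel a (minV (b ∷ x))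
... | inj₁ a⊓≡a = here a⊓≡a
... | inj₂ a⊓≡m = there (subst (_∈ᵥ b ∷ x) (sym a⊓≡m) (minV-∈ (b ∷ x)))

minV-≤ : ∀ {n} (x : Vec ℕ (suc n)) → VAll.All (minV x ≤_) x
minV-≤ (a ∷ [])    = ≤-refl ∷ []
minV-≤ (a ∷ b ∷ x) = m⊓n≤m a _ ∷ VAll.map (≤-trans (m⊓n≤n a _)) (minV-≤ (b ∷ x))

lookup-≤-maxV : ∀ {n} (v : Vec ℕ n) j → lookup v j ≤ maxV v
lookup-≤-maxV (a ∷ v) zero    = m≤m⊔n a _
lookup-≤-maxV (a ∷ v) (suc j) = ≤-trans (lookup-≤-maxV v j) (m≤n⊔m a _)

length-cartesianProductWith : ∀ (f : A → B → C) xs ys →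
                              length (cartesianProductWith f xs ys) ≡ length xs * length ys
length-cartesianProductWith f []       ys = refl
length-cartesianProductWith f (x ∷ xs) ys = begin
  length (map (f x) ys ++ cartesianProductWith f xs ys)        ≡⟨ length-++ (map (f x) ys) ⟩
  length (map (f x) ys) + length (cartesianProductWith f xs ys) ≡⟨ cong₂ _+_ (length-map (f x) ys)
                                                                     (length-cartesianProductWith f xs ys) ⟩
  length ys + length xs * length ys                             ∎
  where open ≡-Reasoning

vectors : List A → ∀ n → List (Vec A n)
vectors as zero    = [ [] ]
vectors as (suc n) = cartesianProductWith V._∷_ as (vectors as n)

∈-vectors : ∀ {as : List A} {n} {v : Vec A n} → VAll.All (_∈ as) v → v ∈ vectors as n
∈-vectors []          = here refl
∈-vectors (a∈ ∷ v∈as) = ∈-cartesianProductWith⁺ V._∷_ a∈ (∈-vectors v∈as)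

length-vectors : ∀ (as : List A) n → length (vectors as n) ≡ length as ^ n
length-vectors as zero    = refl
length-vectors as (suc n) =
  trans (length-cartesianProductWith V._∷_ as (vectors as n)) (cong (length as *_) (length-vectors as n))

-- Out-of-range indices give the junk value 0.
nth : List ℕ → ℕ → ℕ
nth []      _       = 0
nth (b ∷ u) zero    = b
nth (b ∷ u) (suc i) = nth u i

position : List ℕ → ℕ → ℕ
position []      a = 0
position (b ∷ u) a with a ≟ b
... | yes _ = 0
... | no  _ = suc (position u a)

nth-position : ∀ {a} u → a ∈ u → nth u (position u a) ≡ a
nth-position {a} (b ∷ u) a∈ with a ≟ b | a∈
... | yes a≡b | _          = sym a≡b
... | no  a≢b | here a≡b   = ⊥-elim (a≢b a≡b)
... | no  _   | there a∈u  = nth-position u a∈u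

position-< : ∀ {a} u → a ∈ u → position u a < length u
position-< {a} (b ∷ u) a∈ with a ≟ b | a∈
... | yes _   | _          = s≤s z≤n
... | no  a≢b | here a≡b   = ⊥-elim (a≢b a≡b)
... | no  _   | there a∈u  = s≤s (position-< u a∈u)

position-head : ∀ a u → position (a ∷ u) a ≡ 0
position-head a u with a ≟ a
... | yes _  = refl
... | no a≢a = ⊥-elim (a≢a refl)

patterns : ∀ k → List (Vec ℕ k)
patterns k = vectors (upTo k) k

realize : ∀ {n} → Vec ℕ n → List ℕ → Vec ℕ n
realize σ u = V.map (nth u) σ

positions : ∀ {n} → List ℕ → Vec ℕ n → Vec ℕ n
positions u x = V.map (position u) x

realize-positions : ∀ {n u} {x : Vec ℕ n} → VAll.All (_∈ u) x → realize (positions u x) u ≡ x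
realize-positions         []          = refl
realize-positions {u = u} (a∈ ∷ x∈u) = cong₂ _∷_ (nth-position u a∈) (realize-positions x∈u)

positions-∈-upTo : ∀ {n u} {x : Vec ℕ n} → VAll.All (_∈ u) x → VAll.All (_∈ upTo (length u)) (positions u x)
positions-∈-upTo         []          = []
positions-∈-upTo {u = u} (a∈ ∷ x∈u) = ∈-upTo⁺ (position-< u a∈) ∷ positions-∈-upTo x∈u

head-∈-realize : ∀ {n t} {x : Vec ℕ n} v w → t ∈ᵥ x → t ∈ᵥ realize (positions (t ∷ v) x) (t ∷ w)
head-∈-realize {t = t} {x} v w t∈x =
  subst (λ i → nth (t ∷ w) i ∈ᵥ realize (positions (t ∷ v) x) (t ∷ w)) (position-head t v)
        (∈ᵥ-map⁺ (nth (t ∷ w)) (∈ᵥ-map⁺ (position (t ∷ v)) t∈x))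

All-∈-suffix : ∀ {n as bs m} {x : Vec ℕ n} → AllPairs _<_ (as ++ m ∷ bs) →
               VAll.All (_∈ as ++ m ∷ bs) x → VAll.All (m ≤_) x → VAll.All (_∈ m ∷ bs) x
All-∈-suffix {as = as} sorted x∈ m≤x = VAll.map drop-prefix (VAll.zip (x∈ , m≤x))
  where
  drop-prefix : ∀ {y} → y ∈ as ++ _ ∷ _ × _ ≤ y → y ∈ _ ∷ _
  drop-prefix (y∈ , m≤y) with ∈-++⁻ as y∈
  ... | inj₁ y∈as = ⊥-elim (<⇒≱ (AllPairs-∈-prefix as sorted y∈as) m≤y)
  ... | inj₂ y∈   = y∈

module _ {k r : ℕ} (F : Vec ℕ (suc k) → Vec ℕ r) (F-regressive : ∀ x → maxV (F x) ≤ minV x) where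

  colouring : Vec ℕ (suc k) × Fin r → List ℕ → ℕ
  colouring _       []      = 0
  colouring (σ , j) (t ∷ v) = lookup (F (realize σ (t ∷ v))) j ⊓ t

  AllMinHomogeneous : List ℕ → Set
  AllMinHomogeneous H =
    LAll.All (λ χ → MinHomogeneous k (colouring χ) H) (cartesianProduct (patterns (suc k)) (allFin r))

  ramsey-allMinHomogeneous : Ramsey AllMinHomogeneous
  ramsey-allMinHomogeneous = Ramsey-All (λ _ → MinHomogeneous-⊆)
    (λ χ → ramsey-minHomogeneous k (colouring χ) id (λ t v → m⊓n≤n _ t)) _

  F-determined-by-colours : ∀ {t y y′} → t ∈ᵥ y → t ∈ᵥ y′ →
                            (∀ j → lookup (F y) j ⊓ t ≡ lookup (F y′) j ⊓ t) → F y ≡ F y′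
  F-determined-by-colours {t} {y} {y′} t∈y t∈y′ same = begin
    F y                     ≡⟨ tabulate∘lookup (F y) ⟨
    tabulate (lookup (F y))  ≡⟨ tabulate-cong (λ j → trans (sym (below t∈y j)) (trans (same j) (below t∈y′ j))) ⟩
    tabulate (lookup (F y′)) ≡⟨ tabulate∘lookup (F y′) ⟩
    F y′                    ∎
    where
    open ≡-Reasoning
    below : ∀ {z} → t ∈ᵥ z → ∀ j → lookup (F z) j ⊓ t ≡ lookup (F z) j
    below {z} t∈z j =
      m≤n⇒m⊓n≡m (≤-trans (lookup-≤-maxV (F z) j) (≤-trans (F-regressive z) (VAll.lookup (minV-≤ z) t∈z)))

  candidates : ℕ → List ℕ → List (Vec ℕ r)
  candidates zero    _          = []
  candidates (suc n) []         = []
  candidates (suc n) (t ∷ rest) =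
    map (λ σ → F (realize σ (t ∷ take k rest))) (patterns (suc k)) ++ candidates n rest

  length-candidates : ∀ n H → length (candidates n H) ≤ suc k ^ suc k * n
  length-candidates zero    _          = z≤n
  length-candidates (suc n) []         = z≤n
  length-candidates (suc n) (t ∷ rest) = begin
    length (map g (patterns (suc k)) ++ candidates n rest)       ≡⟨ length-++ (map g (patterns (suc k))) ⟩
    length (map g (patterns (suc k))) + length (candidates n rest) ≡⟨ cong (_+ _) |patterns| ⟩
    K + length (candidates n rest)                                ≤⟨ +-monoʳ-≤ K (length-candidates n rest) ⟩
    K + K * n                                                    ≡⟨ *-suc K n ⟨
    K * suc n                                                    ∎
    where
    open ≤-Reasoning
    K = suc k ^ suc k
    g = λ σ → F (realize σ (t ∷ take k rest))
    |patterns| : length (map g (patterns (suc k))) ≡ K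
    |patterns| = trans (length-map g (patterns (suc k))) (trans (length-vectors (upTo (suc k)) (suc k))
                   (cong (_^ suc k) (length-upTo (suc k))))

  ∈-candidates : ∀ n as {t rest σ} → σ ∈ patterns (suc k) → length as < n →
                 F (realize σ (t ∷ take k rest)) ∈ candidates n (as ++ t ∷ rest)
  ∈-candidates (suc n) []       {t} {rest} σ∈ _  = ∈-++⁺ˡ (∈-map⁺ (λ σ → F (realize σ (t ∷ take k rest))) σ∈)
  ∈-candidates (suc n) (_ ∷ as)           σ∈ as< = ∈-++⁺ʳ _ (∈-candidates n as σ∈ (s≤s⁻¹ as<))

  F∈candidates-at : ∀ n as {m rest} {x : Vec ℕ (suc k)} → AllMinHomogeneous (as ++ m ∷ rest) → length as < n →
                    m ∈ᵥ x → Σ (List ℕ) (λ vx → vx ⊆ rest × length vx ≡ k × VAll.All (_∈ m ∷ vx) x) →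
                    F x ∈ candidates n (as ++ m ∷ rest)
  F∈candidates-at n as {m} {rest} {x} allMinHom as<n m∈x (vx , vx⊆ , |vx| , x∈) =
    subst (_∈ candidates n (as ++ m ∷ rest)) (sym Fx≡Fy) (∈-candidates n as σ∈ as<n)
    where
    σ = positions (m ∷ vx) x
    σ∈ : σ ∈ patterns (suc k)
    σ∈ = ∈-vectors (subst (λ l → VAll.All (_∈ upTo l) σ) (cong suc |vx|) (positions-∈-upTo x∈))
    |take-k| : length (take k rest) ≡ k
    |take-k| = length-take-≤ (subst (_≤ length rest) |vx| (length-mono-≤ vx⊆))
    same-colour : ∀ j → colouring (σ , j) (m ∷ vx) ≡ colouring (σ , j) (m ∷ take k rest)
    same-colour j = MinHomogeneous-at as (LAll.lookup allMinHom (∈-cartesianProduct⁺ σ∈ (∈-allFin j)))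
                      vx⊆ (take-⊆ k rest) |vx| |take-k|
    Fx≡Fy : F x ≡ F (realize σ (m ∷ take k rest))
    Fx≡Fy = trans (cong F (sym (realize-positions x∈)))
              (F-determined-by-colours (head-∈-realize vx vx m∈x) (head-∈-realize vx (take k rest) m∈x)
                                       same-colour)

  F∈candidates : ∀ {p H} → AllPairs _<_ H → AllMinHomogeneous H → p + k ≤ length H →
                 ∀ x → VAll.All (_∈ take p H) x → F x ∈ candidates p H
  F∈candidates {p} {H} sorted allMinHom long x x∈E with ∈-∃++ (VAll.lookup x∈E (minV-∈ x))
  ... | as , bs , E≡ =
    subst (λ H → F x ∈ candidates p H) (sym H≡)
      (F∈candidates-at p as (subst AllMinHomogeneous H≡ allMinHom) as<p (minV-∈ x)
        (covering-sublist x m∷bs-unique (minV-∈ x) x∈m∷bs k≤pad))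
    where
    m   = minV x
    pad = drop p H
    H≡ : H ≡ as ++ m ∷ (bs ++ pad)
    H≡ = trans (sym (take++drop≡id p H)) (trans (cong (_++ pad) E≡) (++-assoc as (m ∷ bs) pad))
    sortedE : AllPairs _<_ (as ++ m ∷ bs)
    sortedE = subst (AllPairs _<_) E≡ (AllPairs-resp-⊆ (take-⊆ p H) sorted)
    m∷bs-unique : Unique (m ∷ bs)
    m∷bs-unique = AllPairs.map <⇒≢ (AllPairs-resp-⊆ (++⁺ˡ as ⊆-refl) sortedE)
    x∈m∷bs : VAll.All (_∈ m ∷ bs) x
    x∈m∷bs = All-∈-suffix sortedE (subst (λ E → VAll.All (_∈ E) x) E≡ x∈E) (minV-≤ x)
    as<p : length as < p
    as<p = subst (length as <_) (trans (sym (length-++ as)) (trans (cong length (sym E≡))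
             (length-take-≤ (≤-trans (m≤m+n p k) long)))) (m<m+n (length as) z<s)
    k≤pad : k ≤ length pad
    k≤pad = subst (k ≤_) (sym (length-drop p H)) (m+n≤o⇒m≤o∸n k (subst (_≤ length H) (+-comm p k) long))

theorem0p1 : (k r p : ℕ) → 0 < k → 0 < r → 0 < p →
    (F : Vec ℕ k → Vec ℕ r) →
    ((x : Vec ℕ k) → maxV (F x) ≤ minV x) →
    Σ (List ℕ) λ E → Unique E × length E ≡ p ×
      Σ (List (Vec ℕ r)) λ L → length L ≤ (k ^ k) * p ×
        ((x : Vec ℕ k) → All (_∈ E) x → F x ∈ L)
theorem0p1 (suc k) r p _ _ _ F F-regressive
  with Bar-follow id 0 (ramsey-allMinHomogeneous F F-regressive _ (Bar-length (p + k) [])) refl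
... | m , H , H⊆upTo , allMinHom , long =
  take p H , AllPairs.map <⇒≢ (AllPairs-resp-⊆ (take-⊆ p H) sorted) ,
  length-take-≤ (≤-trans (m≤m+n p k) long) ,
  candidates F F-regressive p H , length-candidates F F-regressive p H ,
  F∈candidates F F-regressive sorted allMinHom long
  where
  sorted : AllPairs _<_ H
  sorted = AllPairs-resp-⊆ H⊆upTo (upTo-sorted m)
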